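{- Let $G$ be a connected interval graph with an interval representation $\{I_v: v\in V(G)\}$, and let $V'$ be a set of non-neighborhood-contained vertices of $G$. Then: (i) there is a linear order $v_1,\dots,v_k$ of $V'$ such that for all $i\in[k-1]$, $I_{v_i}\preceq I_{v_{i+1}}$ or $N_G[v_i]=N_G[v_{i+1}]$; (ii) every linear order of $V'$ obtained in this way (as in (i)) from an interval representation of $G$ is equal to $v_1,\dots,v_k$ or to its reverse $v_k,\dots,v_1$, up to permuting vertices lying in the same twin equivalence class; (iii) for every tidy interval representation $\{I'_v: v\in V(G)\}$ of $G$, the order $v_1,\dots,v_k$ satisfies $I'_{v_i}\preceq I'_{v_{i+1}}$ for all $i\in[k-1]$, or it satisfies $I'_{v_i}\succeq I'_{v_{i+1}}$ for all $i\in[k-1]$.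
   Context: For real intervals, $[\ell,r]\preceq[\ell',r']$ means $\ell\le\ell'$ and $r\le r'$. An interval representation $\{[\ell_v,r_v]\}$ of $G$ is tidy if for every $v$ and every $M\subseteq V(G)$ with $N_G[v]\subseteq N_G[M]=\bigcup_{m\in M}N_G[m]$ we have $[\ell_v,r_v]\subseteq[\min_{m\in M}\ell_m,\max_{m\in M}r_m]$. A vertex $v$ is neighborhood-contained if there is a vertex $w$ with $N_G[v]\subsetneq N_G[w]$, and non-neighborhood-contained otherwise. Twins: $u,v$ are twins if $N_G(u)=N_G(v)$ or $N_G[u]=N_G[v]$; twin equivalence classes are the classes of this (equivalence) relation.
   Formalization: Every interval representation, whether the given one, those in (ii), or the tidy ones in (iii), has rational rather than real endpoints. -}

module Defs where

open import Level using (0ℓ)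
open import Data.Nat using (ℕ)
open import Data.Fin using (Fin)
open import Data.Fin.Subset using (Subset) renaming (_∈_ to _∈ₛ_)
open import Data.Rational using (ℚ; _≤_)
open import Data.Product using (Σ; ∃; _×_; _,_)
open import Data.Sum using (_⊎_)
open import Data.List using (List; reverse)
open import Data.List.Membership.Propositional using (_∈_)
open import Data.List.Relation.Unary.Unique.Propositional using (Unique)
open import Data.List.Relation.Unary.Linked using (Linked)
open import Data.List.Relation.Binary.Pointwise using (Pointwise)
open import Relation.Binary.PropositionalEquality using (_≡_; _≢_)
open import Relation.Binary.Construct.Closure.ReflexiveTransitive using (Star)
open import Relation.Nullary using (¬_)

record Graph (n : ℕ) : Set₁ where
  field
    Adj     : Fin n → Fin n → Set
    symAdj  : ∀ {u v} → Adj u v → Adj v u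
    irrefl  : ∀ {v} → ¬ Adj v v
open Graph public

module _ {n : ℕ} (G : Graph n) where

  N[_] : Fin n → Fin n → Set
  N[ v ] w = w ≡ v ⊎ Adj G v w

  N⟨_⟩ : Fin n → Fin n → Set
  N⟨ v ⟩ w = Adj G v w

  Connected : Set
  Connected = ∀ u v → Star (Adj G) u v

  _⊆ᵥ_ : (Fin n → Set) → (Fin n → Set) → Set
  A ⊆ᵥ B = ∀ x → A x → B x

  _≐ᵥ_ : (Fin n → Set) → (Fin n → Set) → Set
  A ≐ᵥ B = A ⊆ᵥ B × B ⊆ᵥ A

  _⊊ᵥ_ : (Fin n → Set) → (Fin n → Set) → Set
  A ⊊ᵥ B = A ⊆ᵥ B × ¬ (B ⊆ᵥ A)

  NeighborhoodContained : Fin n → Set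
  NeighborhoodContained v = ∃ λ w → N[ v ] ⊊ᵥ N[ w ]

  NonNeighborhoodContained : Fin n → Set
  NonNeighborhoodContained v = ¬ NeighborhoodContained v

  Twin : Fin n → Fin n → Set
  Twin u v = (N⟨ u ⟩ ≐ᵥ N⟨ v ⟩) ⊎ (N[ u ] ≐ᵥ N[ v ])

  record Intervals : Set where
    field
      ℓ : Fin n → ℚ
      r : Fin n → ℚ
  open Intervals public

  _⪯[_]_ : Fin n → Intervals → Fin n → Set
  u ⪯[ I ] v = (ℓ I u ≤ ℓ I v) × (r I u ≤ r I v)

  IsIntervalRep : Intervals → Set
  IsIntervalRep I =
    (∀ v → ℓ I v ≤ r I v) ×
    (∀ u v → u ≢ v →
      (Adj G u v → (ℓ I u ≤ r I v × ℓ I v ≤ r I u)) ×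
      ((ℓ I u ≤ r I v × ℓ I v ≤ r I u) → Adj G u v))

  -- tidy: N[v] ⊆ N[M] implies [ℓ_v,r_v] ⊆ [min_{m∈M} ℓ_m, max_{m∈M} r_m]
  -- (the min/max inclusion written out: some m ∈ M has ℓ_m ≤ ℓ_v, some m ∈ M has r_v ≤ r_m)
  IsTidy : Intervals → Set
  IsTidy I = ∀ (v : Fin n) (M : Subset n) →
    (N[ v ] ⊆ᵥ (λ w → ∃ λ m → m ∈ₛ M × N[ m ] w)) →
    (∃ λ m → m ∈ₛ M × ℓ I m ≤ ℓ I v) × (∃ λ m → m ∈ₛ M × r I v ≤ r I m)

  IsLinearOrderOf : Subset n → List (Fin n) → Set
  IsLinearOrderOf V' σ = Unique σ × (∀ v → (v ∈ σ → v ∈ₛ V') × (v ∈ₛ V' → v ∈ σ))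

  OrderedBy : Intervals → List (Fin n) → Set
  OrderedBy I σ = Linked (λ u v → u ⪯[ I ] v ⊎ (N[ u ] ≐ᵥ N[ v ])) σ

  EqualUpToTwins : List (Fin n) → List (Fin n) → Set
  EqualUpToTwins σ τ = Pointwise Twin σ τ

  Increasing : Intervals → List (Fin n) → Set
  Increasing I σ = Linked (λ u v → u ⪯[ I ] v) σ

  Decreasing : Intervals → List (Fin n) → Set
  Decreasing I σ = Linked (λ u v → v ⪯[ I ] u) σ

{-# OPTIONS --safe #-}
module Submission where

-- Two non-neighbourhood-contained vertices that are not true twins have non-nested
-- intervals, so on such vertices "I_u ⪯ I_v or N[u] = N[v]" is a total order modulo
-- true twins, and sorting V′ by left endpoints gives σ.  The heart of the matter is
-- that two representations I and J of a connected graph induce the same or opposite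
-- orders.  They preserve betweenness: if a ⪯ b ⪯ c in I but b is not between a and c
-- in J, a vertex of N[b] ∖ N[a] separates a from c in one representation while a walk
-- from a to c avoids its neighbourhood in the other.  A betweenness-preserving pair
-- of total orders agrees on all pairs or disagrees on all pairs.  Then (ii) is the
-- uniqueness of sorted permutations, and (iii) holds because a tidy representation
-- gives true twins identical intervals.

open import Defs
open import Level using (0ℓ)
open import Function using (_∘′_; flip; _on_)
open import Function.Bundles using (mk⇔)
open import Data.Nat using (ℕ)
open import Data.Fin using (Fin; _≟_)
open import Data.Fin.Properties using (all?; any?; ¬∀⟶∃¬)
open import Data.Fin.Subset using (Subset; ⁅_⁆) renaming (_∈_ to _∈ₛ_)
open import Data.Fin.Subset.Properties using (_∈?_; x∈⁅x⁆; x∈⁅y⁆⇒x≡y)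
open import Data.Rational using (ℚ; _≤_; _<_; -_)
open import Data.Rational.Properties as ℚ
  using (≤-refl; ≤-trans; ≤-total; _≤?_; <⇒≤; ≰⇒>; <-irrefl; <-≤-trans; ≤-<-trans; neg-antimono-≤)
open import Algebra.Properties.Group ℚ.+-0-group using (⁻¹-involutive)
open import Data.Product using (Σ; ∃; _×_; _,_; proj₁; proj₂)
open import Data.Sum as Sum using (_⊎_; inj₁; inj₂)
open import Data.Empty using (⊥; ⊥-elim)
open import Data.List using (List; []; _∷_; reverse; _ʳ++_; filter; allFin)
open import Data.List.Membership.Propositional.Properties using (∈-filter⁺; ∈-filter⁻; ∈-allFin)
open import Data.List.Membership.Propositional.Properties.WithK using (unique∧set⇒bag)
open import Data.List.Relation.Unary.All as All using (All; []; _∷_; toList)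
open import Data.List.Relation.Unary.Linked as Linked using (Linked; []; [-]; _∷_)
import Data.List.Relation.Unary.Unique.Propositional.Properties as Unique
open import Data.List.Relation.Unary.Sorted.TotalOrder.Properties using (↗↭↗⇒≋)
open import Data.List.Relation.Binary.Pointwise as Pointwise using (Pointwise; []; _∷_)
open import Data.List.Relation.Binary.BagAndSetEquality using (∼bag⇒↭)
open import Data.List.Relation.Binary.Permutation.Propositional as ↭ using (_↭_; ↭-sym; ↭-trans; ↭⇒↭ₛ)
open import Data.List.Relation.Binary.Permutation.Propositional.Properties using (All-resp-↭; ∈-resp-↭; ↭-reverse)
import Data.List.Relation.Binary.Permutation.Setoid.Properties as ↭ₛ
open import Data.List.Relation.Binary.Permutation.Homogeneous as Homogeneous using (Permutation)
open import Relation.Nullary using (¬_; Dec; yes; no)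
open import Relation.Nullary.Decidable using (_×-dec_; _→-dec_; _⊎-dec_; ¬?)
open import Relation.Binary.Core using (Rel)
open import Relation.Binary.Definitions using (Reflexive; Total)
open import Relation.Binary.Structures using (IsEquivalence; IsTotalOrder; IsDecTotalOrder)
open import Relation.Binary.Bundles using (TotalOrder)
import Relation.Binary.Construct.On as On
open import Relation.Binary.PropositionalEquality as ≡ using (refl; sym; subst₂)
open import Relation.Binary.Construct.Closure.ReflexiveTransitive as Star using (Star; ε; _◅_)

<⇒≱ : ∀ {p q} → p < q → ¬ q ≤ p
<⇒≱ p<q q≤p = <-irrefl refl (<-≤-trans p<q q≤p)

neg-cancel-≤ : ∀ {p q} → - p ≤ - q → q ≤ p
neg-cancel-≤ {p} {q} = subst₂ _≤_ (⁻¹-involutive q) (⁻¹-involutive p) ∘′ neg-antimono-≤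

Between : {A : Set} → Rel A 0ℓ → A → A → A → Set
Between _≤_ a b c = (a ≤ b × b ≤ c) ⊎ (c ≤ b × b ≤ a)

some-between : {A : Set} {_≤_ : Rel A 0ℓ} → Total _≤_ → ∀ x y z →
  Between _≤_ y x z ⊎ Between _≤_ x y z ⊎ Between _≤_ x z y
some-between total x y z with total x y | total x z
... | inj₁ x≤y | inj₂ z≤x = inj₁ (inj₂ (z≤x , x≤y))
... | inj₂ y≤x | inj₁ x≤z = inj₁ (inj₁ (y≤x , x≤z))
... | inj₁ x≤y | inj₁ x≤z with total y z
...   | inj₁ y≤z = inj₂ (inj₁ (inj₁ (x≤y , y≤z)))
...   | inj₂ z≤y = inj₂ (inj₂ (inj₁ (x≤z , z≤y)))
some-between total x y z | inj₂ y≤x | inj₂ z≤x with total y z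
...   | inj₁ y≤z = inj₂ (inj₂ (inj₂ (y≤z , z≤x)))
...   | inj₂ z≤y = inj₂ (inj₁ (inj₂ (z≤y , y≤x)))

module Betweenness {A : Set} {_≈_ _≤₁_ _≤₂_ : Rel A 0ℓ}
  (O₁ : IsDecTotalOrder _≈_ _≤₁_) (O₂ : IsTotalOrder _≈_ _≤₂_)
  (preserves : ∀ {a b c} → ¬ a ≈ b → ¬ b ≈ c → ¬ a ≈ c →
               Between _≤₁_ a b c → Between _≤₂_ a b c)
  where

  private
    module O₁ = IsDecTotalOrder O₁
    module O₂ = IsTotalOrder O₂

    ≉-sym : ∀ {a b} → ¬ a ≈ b → ¬ b ≈ a
    ≉-sym a≉b b≈a = a≉b (O₁.Eq.sym b≈a)

  Agree Disagree : A → A → Set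
  Agree a b = (a ≤₁ b × a ≤₂ b) ⊎ (b ≤₁ a × b ≤₂ a)
  Disagree a b = (a ≤₁ b × b ≤₂ a) ⊎ (b ≤₁ a × a ≤₂ b)

  agree-sym : ∀ {a b} → Agree a b → Agree b a
  agree-sym = Sum.swap

  agree-respʳ : ∀ {a b c} → b ≈ c → Agree a b → Agree a c
  agree-respʳ b≈c (inj₁ (p , q)) = inj₁ (O₁.≲-respʳ-≈ b≈c p , O₂.≲-respʳ-≈ b≈c q)
  agree-respʳ b≈c (inj₂ (p , q)) = inj₂ (O₁.≲-respˡ-≈ b≈c p , O₂.≲-respˡ-≈ b≈c q)

  agree∧disagree⇒≈ : ∀ {a b} → Agree a b → Disagree a b → a ≈ b
  agree∧disagree⇒≈ (inj₁ (_ , p)) (inj₁ (_ , q)) = O₂.antisym p q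
  agree∧disagree⇒≈ (inj₁ (p , _)) (inj₂ (q , _)) = O₁.antisym p q
  agree∧disagree⇒≈ (inj₂ (p , _)) (inj₁ (q , _)) = O₁.antisym q p
  agree∧disagree⇒≈ (inj₂ (_ , p)) (inj₂ (_ , q)) = O₂.antisym q p

  Uniform : A → A → A → Set
  Uniform a b c = (Agree a b × Agree b c × Agree a c) ⊎ (Disagree a b × Disagree b c × Disagree a c)

  uniform : ∀ {a b c} → ¬ a ≈ b → ¬ b ≈ c → ¬ a ≈ c → Between _≤₁_ a b c → Uniform a b c
  uniform a≉b b≉c a≉c between₁ with between₁ | preserves a≉b b≉c a≉c between₁
  ... | inj₁ (ab , bc) | inj₁ (ab′ , bc′) =
    inj₁ (inj₁ (ab , ab′) , inj₁ (bc , bc′) , inj₁ (O₁.trans ab bc , O₂.trans ab′ bc′))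
  ... | inj₁ (ab , bc) | inj₂ (cb′ , ba′) =
    inj₂ (inj₁ (ab , ba′) , inj₁ (bc , cb′) , inj₁ (O₁.trans ab bc , O₂.trans cb′ ba′))
  ... | inj₂ (cb , ba) | inj₁ (ab′ , bc′) =
    inj₂ (inj₂ (ba , ab′) , inj₂ (cb , bc′) , inj₂ (O₁.trans cb ba , O₂.trans ab′ bc′))
  ... | inj₂ (cb , ba) | inj₂ (cb′ , ba′) =
    inj₁ (inj₂ (ba , ba′) , inj₂ (cb , cb′) , inj₂ (O₁.trans cb ba , O₂.trans cb′ ba′))

  agree-spread : ∀ {x y z} → ¬ x ≈ y → ¬ x ≈ z → Agree x y → Agree x z
  agree-spread {x} {y} {z} x≉y x≉z xy with y O₁.≟ z
  ... | yes y≈z = agree-respʳ y≈z xy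
  ... | no y≉z with some-between O₁.total x y z
  ...   | inj₁ yxz with uniform (≉-sym x≉y) x≉z y≉z yxz
  ...     | inj₁ (_ , xz , _) = xz
  ...     | inj₂ (yx , _ , _) = ⊥-elim (x≉y (O₁.Eq.sym (agree∧disagree⇒≈ (agree-sym xy) yx)))
  agree-spread x≉y x≉z xy | no y≉z | inj₂ (inj₁ xyz) with uniform x≉y y≉z x≉z xyz
  ...     | inj₁ (_ , _ , xz) = xz
  ...     | inj₂ (xy′ , _ , _) = ⊥-elim (x≉y (agree∧disagree⇒≈ xy xy′))
  agree-spread x≉y x≉z xy | no y≉z | inj₂ (inj₂ xzy) with uniform x≉z (≉-sym y≉z) x≉y xzy
  ...     | inj₁ (xz , _ , _) = xz
  ...     | inj₂ (_ , _ , xy′) = ⊥-elim (x≉y (agree∧disagree⇒≈ xy xy′))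

  agree⇒¬disagree : ∀ {a b c d} → ¬ a ≈ b → ¬ c ≈ d → Agree a b → ¬ Disagree c d
  agree⇒¬disagree {a} {b} {c} {d} a≉b c≉d ab cd with a O₁.≟ c
  ... | yes a≈c = c≉d (agree∧disagree⇒≈ (agree-sym (agree-respʳ a≈c (agree-sym ad))) cd)
    where ad = agree-spread a≉b (λ a≈d → c≉d (O₁.Eq.trans (O₁.Eq.sym a≈c) a≈d)) ab
  ... | no a≉c = c≉d (agree∧disagree⇒≈ cd′ cd)
    where cd′ = agree-spread (≉-sym a≉c) c≉d (agree-sym (agree-spread a≉b a≉c ab))

module _ {A : Set} {P : A → Set} {R S : Rel A 0ℓ} where

  Linked-map-All : (∀ {x y} → P x → P y → R x y → S x y) →
    ∀ {xs} → All P xs → Linked R xs → Linked S xs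
  Linked-map-All f _ [] = []
  Linked-map-All f _ [-] = [-]
  Linked-map-All f (px ∷ py ∷ pxs) (r ∷ rs) = f px py r ∷ Linked-map-All f (py ∷ pxs) rs

module _ {A : Set} {R : Rel A 0ℓ} where

  Linked-ʳ++ : ∀ {x} xs ys → Linked R (x ∷ xs) → Linked (flip R) (x ∷ ys) →
    Linked (flip R) (xs ʳ++ x ∷ ys)
  Linked-ʳ++ [] ys _ rys = rys
  Linked-ʳ++ {x} (y ∷ xs) ys (r ∷ rxs) rys = Linked-ʳ++ xs (x ∷ ys) rxs (r ∷ rys)

  Linked-reverse : ∀ {xs} → Linked R xs → Linked (flip R) (reverse xs)
  Linked-reverse [] = []
  Linked-reverse {x ∷ xs} rxs = Linked-ʳ++ xs [] rxs [-]

module _ {A : Set} {P : A → Set} {R : Rel A 0ℓ} where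

  Linked-toList : ∀ {xs} → Linked R xs → (pxs : All P xs) → Linked (R on proj₁) (toList pxs)
  Linked-toList [] [] = []
  Linked-toList [-] (_ ∷ []) = [-]
  Linked-toList (r ∷ rs) (_ ∷ pxs@(_ ∷ _)) = r ∷ Linked-toList rs pxs

  Pointwise-toList⁻ : ∀ {xs ys} (pxs : All P xs) (pys : All P ys) →
    Pointwise (R on proj₁) (toList pxs) (toList pys) → Pointwise R xs ys
  Pointwise-toList⁻ [] [] [] = []
  Pointwise-toList⁻ (_ ∷ pxs) (_ ∷ pys) (r ∷ rs) = r ∷ Pointwise-toList⁻ pxs pys rs

  module _ (R-refl : Reflexive R) where

    Pointwise-toList : ∀ {xs} (pxs pxs′ : All P xs) → Pointwise (R on proj₁) (toList pxs) (toList pxs′)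
    Pointwise-toList [] [] = []
    Pointwise-toList (_ ∷ pxs) (_ ∷ pxs′) = R-refl ∷ Pointwise-toList pxs pxs′

    ↭-toList : ∀ {xs ys} → xs ↭ ys → (pxs : All P xs) (pys : All P ys) →
      Permutation (R on proj₁) (toList pxs) (toList pys)
    ↭-toList ↭.refl pxs pxs′ = Homogeneous.refl (Pointwise-toList pxs pxs′)
    ↭-toList (↭.prep _ p) (_ ∷ pxs) (_ ∷ pys) = Homogeneous.prep R-refl (↭-toList p pxs pys)
    ↭-toList (↭.swap _ _ p) (_ ∷ _ ∷ pxs) (_ ∷ _ ∷ pys) =
      Homogeneous.swap R-refl R-refl (↭-toList p pxs pys)
    ↭-toList (↭.trans p q) pxs pzs = Homogeneous.trans (↭-toList p pxs pys) (↭-toList q pys pzs)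
      where pys = All-resp-↭ p pxs

module _ {n : ℕ} (G : Graph n) where

  private
    Nb : Fin n → Fin n → Set
    Nb = N[_] G

    NNC : Fin n → Set
    NNC = NonNeighborhoodContained G

  infix 4 _⊆N_

  _⊆N_ : Fin n → Fin n → Set
  u ⊆N v = _⊆ᵥ_ G (Nb u) (Nb v)

  TrueTwins : Fin n → Fin n → Set
  TrueTwins u v = _≐ᵥ_ G (Nb u) (Nb v)

  TrueTwins-isEquivalence : IsEquivalence TrueTwins
  TrueTwins-isEquivalence = record
    { refl = (λ _ h → h) , (λ _ h → h)
    ; sym = λ (p , q) → q , p
    ; trans = λ (p , q) (p′ , q′) → (λ x h → p′ x (p x h)) , (λ x h → q x (q′ x h))
    }

  private module Twins = IsEquivalence TrueTwins-isEquivalence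

  ≁-sym : ∀ {u v} → ¬ TrueTwins u v → ¬ TrueTwins v u
  ≁-sym u≁v v~u = u≁v (Twins.sym v~u)

  N-sym : ∀ {u v} → Nb u v → Nb v u
  N-sym (inj₁ refl) = inj₁ refl
  N-sym (inj₂ a) = inj₂ (symAdj G a)

  _≼[_]_ : Fin n → Intervals G → Fin n → Set
  u ≼[ K ] v = _⪯[_]_ G u K v ⊎ TrueTwins u v

  NNCVertex : Set
  NNCVertex = Σ (Fin n) NNC

  module Representation {K : Intervals G} (rep : IsIntervalRep G K) where

    infix 4 _⪯_ _≼_

    _⪯_ _≼_ : Fin n → Fin n → Set
    u ⪯ v = _⪯[_]_ G u K v
    u ≼ v = u ≼[ K ] v

    Overlap : Fin n → Fin n → Set
    Overlap u v = ℓ K u ≤ r K v × ℓ K v ≤ r K u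

    adj⇒overlap : ∀ {u v} → Adj G u v → Overlap u v
    adj⇒overlap {u} {v} a with u ≟ v
    ... | yes refl = ⊥-elim (irrefl G a)
    ... | no u≢v = proj₁ (proj₂ rep u v u≢v) a

    N⇒overlap : ∀ {u v} → Nb u v → Overlap u v
    N⇒overlap {u} (inj₁ refl) = proj₁ rep u , proj₁ rep u
    N⇒overlap (inj₂ a) = adj⇒overlap a

    overlap⇒N : ∀ {u v} → Overlap u v → Nb u v
    overlap⇒N {u} {v} o with v ≟ u
    ... | yes v≡u = inj₁ v≡u
    ... | no v≢u = inj₂ (proj₂ (proj₂ rep u v (λ u≡v → v≢u (sym u≡v))) o)

    N? : ∀ u v → Dec (Nb u v)
    N? u v with (ℓ K u ≤? r K v) ×-dec (ℓ K v ≤? r K u)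
    ... | yes o = yes (overlap⇒N o)
    ... | no ¬o = no (λ uv → ¬o (N⇒overlap uv))

    ¬N⇒apart : ∀ {u v} → ¬ Nb u v → r K v < ℓ K u ⊎ r K u < ℓ K v
    ¬N⇒apart {u} {v} ¬uv with ℓ K u ≤? r K v | ℓ K v ≤? r K u
    ... | yes p | yes q = ⊥-elim (¬uv (overlap⇒N (p , q)))
    ... | no p | _ = inj₁ (≰⇒> p)
    ... | yes _ | no q = inj₂ (≰⇒> q)

    _⊆N?_ : ∀ u v → Dec (u ⊆N v)
    u ⊆N? v = all? (λ x → N? u x →-dec N? v x)

    ⊈N⇒∃ : ∀ {u v} → ¬ u ⊆N v → ∃ λ w → Nb u w × ¬ Nb v w
    ⊈N⇒∃ {u} {v} u⊈v with ¬∀⟶∃¬ n _ (λ w → N? u w →-dec N? v w) (λ u⊆v → u⊈v λ w → u⊆v w)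
    ... | w , ¬uw⇒vw with N? u w
    ...   | yes uw = w , uw , λ vw → ¬uw⇒vw (λ _ → vw)
    ...   | no ¬uw = ⊥-elim (¬uw⇒vw (λ uw → ⊥-elim (¬uw uw)))

    twins? : ∀ u v → Dec (TrueTwins u v)
    twins? u v = (u ⊆N? v) ×-dec (v ⊆N? u)

    nnc? : ∀ v → Dec (NNC v)
    nnc? v = ¬? (any? (λ w → (v ⊆N? w) ×-dec ¬? (w ⊆N? v)))

    nested⇒⊆N : ∀ {u v} → ℓ K u ≤ ℓ K v → r K v ≤ r K u → v ⊆N u
    nested⇒⊆N ℓuv rvu x vx = let (p , q) = N⇒overlap vx in overlap⇒N (≤-trans ℓuv p , ≤-trans q rvu)

    nnc-⊆N⇒twins : ∀ {u v} → NNC u → u ⊆N v → TrueTwins u v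
    nnc-⊆N⇒twins {u} {v} nnc u⊆v with v ⊆N? u
    ... | yes v⊆u = u⊆v , v⊆u
    ... | no v⊈u = ⊥-elim (nnc (v , u⊆v , v⊈u))

    ⪯-antisym : ∀ {u v} → u ⪯ v → v ⪯ u → TrueTwins u v
    ⪯-antisym (ℓuv , ruv) (ℓvu , rvu) = nested⇒⊆N ℓvu ruv , nested⇒⊆N ℓuv rvu

    ℓ≤⇒≼ : ∀ {u v} → NNC v → ℓ K u ≤ ℓ K v → u ≼ v
    ℓ≤⇒≼ {u} {v} nv ℓuv with r K u ≤? r K v
    ... | yes ruv = inj₁ (ℓuv , ruv)
    ... | no ruv = inj₂ (Twins.sym (nnc-⊆N⇒twins nv (nested⇒⊆N ℓuv (<⇒≤ (≰⇒> ruv)))))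

    ≼-total : ∀ {u v} → NNC u → NNC v → u ≼ v ⊎ v ≼ u
    ≼-total {u} {v} nu nv with ≤-total (ℓ K u) (ℓ K v)
    ... | inj₁ ℓuv = inj₁ (ℓ≤⇒≼ nv ℓuv)
    ... | inj₂ ℓvu = inj₂ (ℓ≤⇒≼ nu ℓvu)

    sandwich : ∀ {u v w} → u ⪯ w → w ⪯ v → TrueTwins u v → w ⊆N u
    sandwich {u} {v} {w} (ℓuw , _) (_ , rwv) (_ , v⊆u) x wx with ℓ K x ≤? r K u
    ... | yes ℓx≤ru = overlap⇒N (≤-trans ℓuw (proj₁ (N⇒overlap wx)) , ℓx≤ru)
    ... | no ℓx≰ru = v⊆u x (overlap⇒N (ℓv≤rx , ≤-trans (proj₂ (N⇒overlap wx)) rwv))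
      where
      ℓv≤rx : ℓ K v ≤ r K x
      ℓv≤rx = ≤-trans (proj₂ (N⇒overlap (v⊆u v (inj₁ refl))))
                (≤-trans (<⇒≤ (≰⇒> ℓx≰ru)) (proj₁ rep x))

    ≼-trans : ∀ {u v w} → NNC u → NNC w → u ≼ v → v ≼ w → u ≼ w
    ≼-trans _ _ (inj₁ (ℓuv , ruv)) (inj₁ (ℓvw , rvw)) = inj₁ (≤-trans ℓuv ℓvw , ≤-trans ruv rvw)
    ≼-trans _ _ (inj₂ u~v) (inj₂ v~w) = inj₂ (Twins.trans u~v v~w)
    ≼-trans nu nw (inj₁ u⪯v) (inj₂ v~w) with ≼-total nu nw
    ... | inj₁ u≼w = u≼w
    ... | inj₂ (inj₂ w~u) = inj₂ (Twins.sym w~u)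
    ... | inj₂ (inj₁ w⪯u) = inj₂ (nnc-⊆N⇒twins nu (sandwich w⪯u u⪯v (Twins.sym v~w)))
    ≼-trans nu nw (inj₂ u~v) (inj₁ v⪯w) with ≼-total nu nw
    ... | inj₁ u≼w = u≼w
    ... | inj₂ (inj₂ w~u) = inj₂ (Twins.sym w~u)
    ... | inj₂ (inj₁ w⪯u) =
      inj₂ (Twins.trans u~v (Twins.sym (nnc-⊆N⇒twins nw (sandwich v⪯w w⪯u (Twins.sym u~v)))))

    ≼-antisym : ∀ {u v} → u ≼ v → v ≼ u → TrueTwins u v
    ≼-antisym (inj₁ u⪯v) (inj₁ v⪯u) = ⪯-antisym u⪯v v⪯u
    ≼-antisym (inj₂ u~v) _ = u~v
    ≼-antisym (inj₁ _) (inj₂ v~u) = Twins.sym v~u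

    ≼⇒⪯ : ∀ {u v} → ¬ TrueTwins u v → u ≼ v → u ⪯ v
    ≼⇒⪯ _ (inj₁ u⪯v) = u⪯v
    ≼⇒⪯ u≁v (inj₂ u~v) = ⊥-elim (u≁v u~v)

    _≼?_ : ∀ u v → Dec (u ≼ v)
    u ≼? v = ((ℓ K u ≤? ℓ K v) ×-dec (r K u ≤? r K v)) ⊎-dec twins? u v

    ≼-isDecTotalOrder : IsDecTotalOrder {A = NNCVertex} (TrueTwins on proj₁) (_≼_ on proj₁)
    ≼-isDecTotalOrder = record
      { isTotalOrder = record
        { isPartialOrder = record
          { isPreorder = record
            { isEquivalence = On.isEquivalence proj₁ TrueTwins-isEquivalence
            ; reflexive = inj₂
            ; trans = λ {a} {_} {c} → ≼-trans (proj₂ a) (proj₂ c)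
            }
          ; antisym = ≼-antisym
          }
        ; total = λ a b → ≼-total (proj₂ a) (proj₂ b)
        }
      ; _≟_ = λ a b → twins? (proj₁ a) (proj₁ b)
      ; _≤?_ = λ a b → proj₁ a ≼? proj₁ b
      }

    ≼-totalOrder : TotalOrder 0ℓ 0ℓ 0ℓ
    ≼-totalOrder = record { isTotalOrder = IsDecTotalOrder.isTotalOrder ≼-isDecTotalOrder }

    module _ (p : ℚ) where

      AdjAbove : Fin n → Fin n → Set
      AdjAbove a b = Adj G a b × p ≤ r K b

      walk-above : ∀ {u v} → p ≤ r K u → p ≤ r K v → Star (Adj G) u v → Star AdjAbove u v
      walk-above-resume : ∀ {u w v} → ℓ K u ≤ p → p ≤ r K u → r K w < p → p ≤ r K v →
        Star (Adj G) w v → Star AdjAbove u v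

      walk-above pu pv ε = ε
      walk-above pu pv (_◅_ {j = w} uw rest) with p ≤? r K w
      ... | yes pw = (uw , pw) ◅ walk-above pw pv rest
      ... | no pw =
        walk-above-resume (≤-trans (proj₁ (adj⇒overlap uw)) (<⇒≤ (≰⇒> pw))) pu (≰⇒> pw) pv rest

      walk-above-resume _ _ wp pv ε = ⊥-elim (<⇒≱ wp pv)
      walk-above-resume {u} ℓu pu wp pv (_◅_ {j = w′} ww′ rest) with p ≤? r K w′
      ... | no pw′ = walk-above-resume ℓu pu (≰⇒> pw′) pv rest
      ... | yes pw′
        with overlap⇒N {u} {w′}
               (≤-trans ℓu pw′ , ≤-trans (<⇒≤ (≤-<-trans (proj₂ (adj⇒overlap ww′)) wp)) pu)
      ...   | inj₁ refl = walk-above pu pv rest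
      ...   | inj₂ uw′ = (uw′ , pw′) ◅ walk-above pw′ pv rest

    AdjAvoiding : Fin n → Fin n → Fin n → Set
    AdjAvoiding β a b = Adj G a b × ¬ Nb β b

    no-walk-across : ∀ {β u v} → r K u < ℓ K β → r K β < ℓ K v → ¬ Star (AdjAvoiding β) u v
    no-walk-across {β} uβ βv ε = <⇒≱ uβ (≤-trans (proj₁ rep β) (≤-trans (<⇒≤ βv) (proj₁ rep _)))
    no-walk-across {β} uβ βv ((uw , ¬βw) ◅ rest) with ¬N⇒apart ¬βw
    ... | inj₁ wβ = no-walk-across wβ βv rest
    ... | inj₂ βw = <⇒≱ βw (≤-trans (proj₂ (adj⇒overlap uw)) (≤-trans (<⇒≤ uβ) (proj₁ rep β)))

  reflect : Intervals G → Intervals G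
  reflect K = record { ℓ = λ v → - r K v ; r = λ v → - ℓ K v }

  reflect-isIntervalRep : ∀ {K} → IsIntervalRep G K → IsIntervalRep G (reflect K)
  reflect-isIntervalRep (ℓ≤r , adj⇔overlap) =
    (λ v → neg-antimono-≤ (ℓ≤r v)) ,
    λ u v u≢v →
      (λ a → let (p , q) = proj₁ (adj⇔overlap u v u≢v) a in neg-antimono-≤ q , neg-antimono-≤ p) ,
      (λ (p , q) → proj₂ (adj⇔overlap u v u≢v) (neg-cancel-≤ q , neg-cancel-≤ p))

  ⪯-reflect : ∀ {K u v} → _⪯[_]_ G u K v → _⪯[_]_ G v (reflect K) u
  ⪯-reflect (ℓuv , ruv) = neg-antimono-≤ ruv , neg-antimono-≤ ℓuv

  ≼-reflect : ∀ {K u v} → u ≼[ K ] v → v ≼[ reflect K ] u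
  ≼-reflect {K} (inj₁ u⪯v) = inj₁ (⪯-reflect {K} u⪯v)
  ≼-reflect (inj₂ u~v) = inj₂ (Twins.sym u~v)

  module _ (conn : Connected G) where

    -- β ∈ N[y] ∖ N[x] lies strictly between x and z in K₁, but left of x in K₂.  Walking
    -- from x to z in K₂ through intervals reaching past r₂(x) avoids N[β], since x is not
    -- neighbourhood-contained; in K₁ such a walk would have to jump over β.
    no-swap-left-of : ∀ {K₁ K₂} → IsIntervalRep G K₁ → IsIntervalRep G K₂ →
      ∀ {x y z} → NNC x → NNC y → ¬ TrueTwins x y →
      _⪯[_]_ G x K₁ y → _⪯[_]_ G y K₁ z → _⪯[_]_ G y K₂ x → _⪯[_]_ G x K₂ z → ⊥
    no-swap-left-of {K₁} {K₂} rep₁ rep₂ {x} {y} {z} nx ny x≁y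
                    (ℓ₁xy , _) (_ , r₁yz) (_ , r₂yx) (ℓ₂xz , r₂xz) =
      R₁.no-walk-across x<β β<z (Star.map avoid (R₂.walk-above (r K₂ x) ≤-refl r₂xz (conn x z)))
      where
      module R₁ = Representation rep₁
      module R₂ = Representation rep₂

      y⊈x : ¬ y ⊆N x
      y⊈x y⊆x = x≁y (Twins.sym (R₁.nnc-⊆N⇒twins ny y⊆x))

      β : Fin n
      β = proj₁ (R₁.⊈N⇒∃ y⊈x)

      yβ : Nb y β
      yβ = proj₁ (proj₂ (R₁.⊈N⇒∃ y⊈x))

      ¬xβ : ¬ Nb x β
      ¬xβ = proj₂ (proj₂ (R₁.⊈N⇒∃ y⊈x))

      β<x₂ : r K₂ β < ℓ K₂ x
      β<x₂ with R₂.¬N⇒apart ¬xβ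
      ... | inj₁ βx = βx
      ... | inj₂ xβ = ⊥-elim (<⇒≱ xβ (≤-trans (proj₂ (R₂.N⇒overlap yβ)) r₂yx))

      x<β : r K₁ x < ℓ K₁ β
      x<β with R₁.¬N⇒apart ¬xβ
      ... | inj₁ βx = ⊥-elim (<⇒≱ βx (≤-trans ℓ₁xy (proj₁ (R₁.N⇒overlap yβ))))
      ... | inj₂ xβ = xβ

      β<z : r K₁ β < ℓ K₁ z
      β<z with R₁.¬N⇒apart {z} {β} (λ zβ → <⇒≱ β<x₂ (≤-trans ℓ₂xz (proj₁ (R₂.N⇒overlap zβ))))
      ... | inj₁ βz = βz
      ... | inj₂ zβ = ⊥-elim (<⇒≱ zβ (≤-trans (proj₂ (R₁.N⇒overlap yβ)) r₁yz))

      avoid : ∀ {a b} → R₂.AdjAbove (r K₂ x) a b → R₁.AdjAvoiding β a b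
      avoid (ab , r₂x≤r₂b) = ab , λ βb →
        let x⊆b = R₂.nested⇒⊆N (<⇒≤ (≤-<-trans (proj₂ (R₂.N⇒overlap βb)) β<x₂)) r₂x≤r₂b
        in ¬xβ (proj₂ (R₂.nnc-⊆N⇒twins nx x⊆b) β (N-sym βb))

    middle-not-leftmost : ∀ {I J} → IsIntervalRep G I → IsIntervalRep G J →
      ∀ {a b c} → NNC a → NNC b → NNC c → ¬ TrueTwins a b → ¬ TrueTwins b c → ¬ TrueTwins a c →
      _⪯[_]_ G a I b → _⪯[_]_ G b I c → _⪯[_]_ G b J a → _⪯[_]_ G b J c → ⊥
    middle-not-leftmost {I} repI repJ na nb nc a≁b b≁c a≁c ab bc ba′ bc′
      with Representation.≼-total repJ na nc
    ... | inj₁ ac′ = no-swap-left-of repI repJ na nb a≁b ab bc ba′ (Representation.≼⇒⪯ repJ a≁c ac′)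
    ... | inj₂ ca′ = no-swap-left-of (reflect-isIntervalRep repI) repJ nc nb (≁-sym b≁c)
      (⪯-reflect {I} bc) (⪯-reflect {I} ab) bc′ (Representation.≼⇒⪯ repJ (≁-sym a≁c) ca′)

    module _ {I J} (repI : IsIntervalRep G I) (repJ : IsIntervalRep G J) where

      private
        module RI = Representation repI
        module RJ = Representation repJ

      ⪯-preservesBetweenness : ∀ {a b c} → NNC a → NNC b → NNC c →
        ¬ TrueTwins a b → ¬ TrueTwins b c → ¬ TrueTwins a c →
        _⪯[_]_ G a I b → _⪯[_]_ G b I c → Between (_≼[ J ]_) a b c
      ⪯-preservesBetweenness na nb nc a≁b b≁c a≁c ab bc with RJ.≼-total na nb | RJ.≼-total nb nc
      ... | inj₁ ab′ | inj₁ bc′ = inj₁ (ab′ , bc′)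
      ... | inj₂ ba′ | inj₂ cb′ = inj₂ (cb′ , ba′)
      ... | inj₂ ba′ | inj₁ bc′ = ⊥-elim (middle-not-leftmost repI repJ na nb nc a≁b b≁c a≁c ab bc
        (RJ.≼⇒⪯ (≁-sym a≁b) ba′) (RJ.≼⇒⪯ b≁c bc′))
      ... | inj₁ ab′ | inj₂ cb′ = ⊥-elim (middle-not-leftmost repI (reflect-isIntervalRep repJ)
        na nb nc a≁b b≁c a≁c ab bc
        (⪯-reflect {J} (RJ.≼⇒⪯ a≁b ab′)) (⪯-reflect {J} (RJ.≼⇒⪯ (≁-sym b≁c) cb′)))

      ≼-preservesBetweenness : ∀ {a b c} → NNC a → NNC b → NNC c →
        ¬ TrueTwins a b → ¬ TrueTwins b c → ¬ TrueTwins a c →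
        Between (_≼[ I ]_) a b c → Between (_≼[ J ]_) a b c
      ≼-preservesBetweenness na nb nc a≁b b≁c a≁c (inj₁ (ab , bc)) =
        ⪯-preservesBetweenness na nb nc a≁b b≁c a≁c (RI.≼⇒⪯ a≁b ab) (RI.≼⇒⪯ b≁c bc)
      ≼-preservesBetweenness na nb nc a≁b b≁c a≁c (inj₂ (cb , ba)) = Sum.swap
        (⪯-preservesBetweenness nc nb na (≁-sym b≁c) (≁-sym a≁b) (≁-sym a≁c)
          (RI.≼⇒⪯ (≁-sym b≁c) cb) (RI.≼⇒⪯ (≁-sym a≁b) ba))

      open Betweenness RI.≼-isDecTotalOrder (IsDecTotalOrder.isTotalOrder RJ.≼-isDecTotalOrder)
        (λ {a} {b} {c} → ≼-preservesBetweenness (proj₂ a) (proj₂ b) (proj₂ c))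
        using (agree⇒¬disagree)

      orientation : (∀ {u v} → NNC u → NNC v → u ≼[ I ] v → u ≼[ J ] v)
                  ⊎ (∀ {u v} → NNC u → NNC v → u ≼[ I ] v → v ≼[ J ] u)
      orientation with any? (λ c → any? (λ d →
        RI.nnc? c ×-dec RI.nnc? d ×-dec ¬? (RI.twins? c d) ×-dec (c RI.≼? d) ×-dec (d RJ.≼? c)))
      ... | yes (c , d , nc , nd , c≁d , cd , dc′) = inj₂ reversed
        where
        reversed : ∀ {u v} → NNC u → NNC v → u ≼[ I ] v → v ≼[ J ] u
        reversed {u} {v} nu nv uv with RI.twins? u v | RJ.≼-total nu nv
        ... | yes u~v | _ = inj₂ (Twins.sym u~v)
        ... | no _ | inj₂ vu′ = vu′
        ... | no u≁v | inj₁ uv′ = ⊥-elim (agree⇒¬disagree {u , nu} {v , nv} {c , nc} {d , nd}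
          u≁v c≁d (inj₁ (uv , uv′)) (inj₁ (cd , dc′)))
      ... | no ∄disagreeing = inj₁ preserved
        where
        preserved : ∀ {u v} → NNC u → NNC v → u ≼[ I ] v → u ≼[ J ] v
        preserved {u} {v} nu nv uv with RI.twins? u v | RJ.≼-total nu nv
        ... | yes u~v | _ = inj₂ u~v
        ... | no _ | inj₁ uv′ = uv′
        ... | no u≁v | inj₂ vu′ = ⊥-elim (∄disagreeing (u , v , nu , nv , u≁v , uv , vu′))

  tidy-≼⇒⪯ : ∀ {K u v} → IsTidy G K → u ≼[ K ] v → _⪯[_]_ G u K v
  tidy-≼⇒⪯ _ (inj₁ u⪯v) = u⪯v
  tidy-≼⇒⪯ {K} {u} {v} tidy (inj₂ (u⊆v , v⊆u))
    with tidy v ⁅ u ⁆ (λ x vx → u , x∈⁅x⁆ u , v⊆u x vx)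
       | tidy u ⁅ v ⁆ (λ x ux → v , x∈⁅x⁆ v , u⊆v x ux)
  ... | (m , m∈⁅u⁆ , ℓm≤ℓv) , _ | _ , (m′ , m′∈⁅v⁆ , ru≤rm′)
    with refl ← x∈⁅y⁆⇒x≡y u m∈⁅u⁆ | refl ← x∈⁅y⁆⇒x≡y v m′∈⁅v⁆ = ℓm≤ℓv , ru≤rm′

  -- ≼ is a total order only on non-neighbourhood-contained vertices, hence the detour
  -- through lists of NNCVertex to apply ↗↭↗⇒≋.
  orderedBy-unique : ∀ {K} → IsIntervalRep G K → ∀ {σ τ} → All NNC τ → σ ↭ τ →
    OrderedBy G K σ → OrderedBy G K τ → EqualUpToTwins G σ τ
  orderedBy-unique rep nτ σ↭τ σ-ordered τ-ordered = Pointwise.map inj₂ (Pointwise-toList⁻ nσ nτ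
    (↗↭↗⇒≋ (Representation.≼-totalOrder rep) (Linked-toList σ-ordered nσ) (Linked-toList τ-ordered nτ)
      (↭-toList Twins.refl σ↭τ nσ nτ)))
    where nσ = All-resp-↭ (↭-sym σ↭τ) nτ

  module _ {V′ : Subset n} where

    linearOrder-All : ∀ {P : Fin n → Set} {σ} → (∀ v → v ∈ₛ V′ → P v) →
      IsLinearOrderOf G V′ σ → All P σ
    linearOrder-All V′⊆P (_ , σ∈) = All.tabulate (λ {v} v∈σ → V′⊆P v (proj₁ (σ∈ v) v∈σ))

    linearOrders-↭ : ∀ {σ τ} → IsLinearOrderOf G V′ σ → IsLinearOrderOf G V′ τ → σ ↭ τ
    linearOrders-↭ (σ! , σ∈) (τ! , τ∈) = ∼bag⇒↭ (unique∧set⇒bag σ! τ! λ {v} →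
      mk⇔ (λ v∈σ → proj₂ (τ∈ v) (proj₁ (σ∈ v) v∈σ)) (λ v∈τ → proj₂ (σ∈ v) (proj₁ (τ∈ v) v∈τ)))

    IsLinearOrderOf-resp-↭ : ∀ {σ τ} → σ ↭ τ → IsLinearOrderOf G V′ σ → IsLinearOrderOf G V′ τ
    IsLinearOrderOf-resp-↭ σ↭τ (σ! , σ∈) =
      ↭ₛ.Unique-resp-↭ (≡.setoid (Fin n)) (↭⇒↭ₛ σ↭τ) σ! ,
      λ v → (λ v∈τ → proj₁ (σ∈ v) (∈-resp-↭ (↭-sym σ↭τ) v∈τ)) ,
            (λ v∈V′ → ∈-resp-↭ σ↭τ (proj₂ (σ∈ v) v∈V′))

    filter-isLinearOrder : IsLinearOrderOf G V′ (filter (_∈? V′) (allFin n))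
    filter-isLinearOrder = Unique.filter⁺ (_∈? V′) (Unique.allFin⁺ n) ,
      λ v → (λ v∈ → proj₂ (∈-filter⁻ (_∈? V′) {xs = allFin n} v∈)) , ∈-filter⁺ (_∈? V′) (∈-allFin v)

    module _ (V′⊆NNC : ∀ v → v ∈ₛ V′ → NNC v) where

      sorted-enumeration : ∀ {I} → IsIntervalRep G I → ∃ λ σ → IsLinearOrderOf G V′ σ × OrderedBy G I σ
      sorted-enumeration {I} rep = σ , σ-linear ,
        Linked-map-All (λ _ nv → Representation.ℓ≤⇒≼ rep nv) (linearOrder-All V′⊆NNC σ-linear) (sort-↗ xs)
        where
        open import Data.List.Sort (On.decTotalOrder ℚ.≤-decTotalOrder (ℓ I)) using (sort; sort-↭; sort-↗)
        xs σ : List (Fin n)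
        xs = filter (_∈? V′) (allFin n)
        σ = sort xs
        σ-linear : IsLinearOrderOf G V′ σ
        σ-linear = IsLinearOrderOf-resp-↭ (↭-sym (sort-↭ xs)) filter-isLinearOrder

      module _ (conn : Connected G) {I σ} (repI : IsIntervalRep G I)
               (σ-linear : IsLinearOrderOf G V′ σ) (σ-ordered : OrderedBy G I σ) where

        private
          σ-nnc : All NNC σ
          σ-nnc = linearOrder-All V′⊆NNC σ-linear

        module _ {J τ} (repJ : IsIntervalRep G J)
                 (τ-linear : IsLinearOrderOf G V′ τ) (τ-ordered : OrderedBy G J τ) where

          private
            τ-nnc : All NNC τ
            τ-nnc = linearOrder-All V′⊆NNC τ-linear

            σ↭τ : σ ↭ τ
            σ↭τ = linearOrders-↭ σ-linear τ-linear

          enumeration-unique-up-to-reversal : EqualUpToTwins G σ τ ⊎ EqualUpToTwins G (reverse σ) τ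
          enumeration-unique-up-to-reversal with orientation conn repJ repI
          ... | inj₁ J⇒I =
            inj₁ (orderedBy-unique repI τ-nnc σ↭τ σ-ordered (Linked-map-All J⇒I τ-nnc τ-ordered))
          ... | inj₂ J⇒Iᵒᵖ =
            inj₂ (orderedBy-unique (reflect-isIntervalRep repI) τ-nnc (↭-trans (↭-reverse σ) σ↭τ)
              (Linked.map (≼-reflect {I}) (Linked-reverse σ-ordered))
              (Linked-map-All (λ nu nv → ≼-reflect {I} ∘′ J⇒Iᵒᵖ nu nv) τ-nnc τ-ordered))

        enumeration-monotone-in-tidy : ∀ {I′} → IsIntervalRep G I′ → IsTidy G I′ →
          Increasing G I′ σ ⊎ Decreasing G I′ σ
        enumeration-monotone-in-tidy repI′ tidy with orientation conn repI repI′
        ... | inj₁ I⇒I′ = inj₁ (Linked-map-All (λ nu nv → tidy-≼⇒⪯ tidy ∘′ I⇒I′ nu nv) σ-nnc σ-ordered)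
        ... | inj₂ I⇒I′ᵒᵖ = inj₂ (Linked-map-All (λ nu nv → tidy-≼⇒⪯ tidy ∘′ I⇒I′ᵒᵖ nu nv) σ-nnc σ-ordered)

lemma10 : ∀ {n : ℕ} (G : Graph n) → Connected G →
    (I : Intervals G) → IsIntervalRep G I →
    (V' : Subset n) → (∀ v → v ∈ₛ V' → NonNeighborhoodContained G v) →
    ∃ λ (σ : List (Fin n)) →
      IsLinearOrderOf G V' σ × OrderedBy G I σ ×
      (∀ (J : Intervals G) → IsIntervalRep G J → (τ : List (Fin n)) →
        IsLinearOrderOf G V' τ → OrderedBy G J τ →
        EqualUpToTwins G σ τ ⊎ EqualUpToTwins G (reverse σ) τ) ×
      (∀ (I' : Intervals G) → IsIntervalRep G I' → IsTidy G I' →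
        Increasing G I' σ ⊎ Decreasing G I' σ)
lemma10 G conn I repI V' V'⊆NNC with sorted-enumeration G V'⊆NNC repI
... | σ , σ-linear , σ-ordered = σ , σ-linear , σ-ordered ,
  (λ J repJ τ τ-linear τ-ordered →
    enumeration-unique-up-to-reversal G V'⊆NNC conn repI σ-linear σ-ordered repJ τ-linear τ-ordered) ,
  (λ I' repI' tidy → enumeration-monotone-in-tidy G V'⊆NNC conn repI σ-linear σ-ordered repI' tidy)
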